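{- Let $p\ge2$, let $m_1,\dots,m_p$ be positive integers, and let $P_1=(x_1,\dots,x_p)$, $P_2=(y_1,\dots,y_p)$ be points of $\mathcal{S}^p$. Then there exists an integer $k\ge0$ with $F^k(P_1)=P_2$ if and only if there exist $k_1,\dots,k_p\in\{0,1\}$ such that the system of Diophantine equations \[2n_1m_1-x_1+(-1)^{k_1}y_1=2n_2m_2-x_2+(-1)^{k_2}y_2=\cdots=2n_pm_p-x_p+(-1)^{k_p}y_p\] has an integer solution $(n_1,\dots,n_p)$.
   Context: $\mathcal{S}^p=\{(x_1,\dots,x_p)\in\mathbb{Z}^p: 0\le x_i\le m_i,\ i=1,\dots,p\}$ is the $m_1\times\cdots\times m_p$ spatial grid. For a positive integer $m$ let $\varphi_m(u)=\min_{n\in\mathbb{Z}}|u-2nm|$ for $u\in\mathbb{Z}$ (the $2m$-periodic triangle wave with $\varphi_m(u)=u$ for $0\le u\le m$). For $k\in\mathbb{Z}$ put $f_i^k(x)=\varphi_{m_i}(x+k)$ and $F^k(x_1,\dots,x_p)=(f_1^k(x_1),\dots,f_p^k(x_p))$: the position after $k$ steps of a light beam started at the given point in direction $(+1,\dots,+1)$, moving along diagonals of unit cubes and reflecting in the mirror boundary of the box $\prod_i[0,m_i]$. "The light starting from $P_1$ passes through $P_2$" means $F^k(P_1)=P_2$ for some $k\ge0$. -}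

module Defs where

open import Data.Nat using (ℕ)
open import Data.Integer using (ℤ; +_; _+_; _-_; _*_; -_; _≤_; ∣_∣; _◃_)
open import Data.Fin using (Fin)
open import Data.Product using (Σ; _×_)
open import Relation.Binary.PropositionalEquality using (_≡_)

abs : ℤ → ℤ
abs u = + ∣ u ∣

-- "φ_m(u) = v", where φ_m(u) = min_{n ∈ ℤ} |u - 2nm| (the minimum of a set
-- of naturals, which always exists; stated literally as: v is attained and
-- is a lower bound).
IsPhi : ℕ → ℤ → ℤ → Set
IsPhi m u v = Σ ℤ (λ n → v ≡ abs (u - (+ 2) * n * (+ m)))
            × ((n : ℤ) → v ≤ abs (u - (+ 2) * n * (+ m)))

InGrid : (p : ℕ) → (Fin p → ℕ) → (Fin p → ℤ) → Set
InGrid p m x = (i : Fin p) → (+ 0 ≤ x i) × (x i ≤ + m i)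

-- F^k(P) = Q, i.e. f_i^k(x_i) = φ_{m_i}(x_i + k) = y_i for every i
FPow≡ : (p : ℕ) → (Fin p → ℕ) → ℕ → (Fin p → ℤ) → (Fin p → ℤ) → Set
FPow≡ p m k x y = (i : Fin p) → IsPhi (m i) (x i + + k) (y i)

sgnPow : Fin 2 → ℤ
sgnPow Fin.zero = + 1
sgnPow (Fin.suc Fin.zero) = - (+ 1)

lhsTerm : ℕ → ℤ → ℤ → Fin 2 → ℤ → ℤ
lhsTerm mi xi yi ki ni = (+ 2) * ni * (+ mi) - xi + sgnPow ki * yi

{-# OPTIONS --safe #-}
module Submission where

-- For 0 ≤ v ≤ m, the fold φ_m sends u to v exactly when u ≡ ±v (mod 2m): the
-- witness n of φ_m(u) = v gives u = 2nm ± v, and conversely every other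
-- candidate |u − 2n'm| = |2(n − n')m ± v| is at least v because v ≤ m.
-- Hence F^k(P₁) = P₂ says precisely that k is a common value of the terms
-- 2nᵢmᵢ − xᵢ ± yᵢ. A common value c of these terms need not be a natural
-- number, but shifting every nᵢ by a multiple of L/mᵢ, for a common multiple
-- L of the mᵢ, moves c by an arbitrary multiple of 2L, so c can be made ≥ 0.

open import Defs
open import Data.Nat using (ℕ; _≤_; _<_; NonZero; >-nonZero)
open import Data.Integer using (ℤ; +_; -[1+_]; _+_; _-_; _*_; -_; +≤+)
import Data.Nat as ℕ
import Data.Nat.Properties as ℕ
import Data.Integer as ℤ
import Data.Integer.Properties as ℤ
open import Data.Nat.Divisibility using (_∣_; divides; m∣m*n; ∣n⇒∣m*n)
open import Data.Integer.DivMod using (_/ℕ_; _%ℕ_; a≡a%ℕn+[a/ℕn]*n)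
open import Data.Integer.Tactic.RingSolver using (solve-∀)
open import Data.Fin using (Fin; zero; suc)
open import Data.Product using (Σ; _×_; _,_; proj₁; proj₂)
open import Function.Bundles using (_⇔_; mk⇔; Equivalence)
open import Relation.Binary.PropositionalEquality
  using (_≡_; refl; sym; trans; cong; cong₂; subst; module ≡-Reasoning)

sgnPow-abs : ∀ z → Σ (Fin 2) λ s → sgnPow s * abs z ≡ z
sgnPow-abs (+ j)    = zero , ℤ.*-identityˡ (+ j)
sgnPow-abs -[1+ j ] = suc zero , ℤ.-1*i≡-i (+ ℕ.suc j)

abs-neg : ∀ z → abs (- z) ≡ abs z
abs-neg z = cong +_ (ℤ.∣-i∣≡∣i∣ z)

abs-sgnPow : ∀ s z → abs (sgnPow s * z) ≡ abs z
abs-sgnPow zero       z = cong abs (ℤ.*-identityˡ z)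
abs-sgnPow (suc zero) z = trans (cong abs (ℤ.-1*i≡-i z)) (abs-neg z)

pos-*³ : ∀ a b c → + a * + b * + c ≡ + (a ℕ.* b ℕ.* c)
pos-*³ a b c = sym (trans (ℤ.pos-* (a ℕ.* b) c) (cong (_* + c) (ℤ.pos-* a b)))

abs-fold-lowerBound : ∀ {a m} → a ≤ m → ∀ d → + a ℤ.≤ abs (+ 2 * d * + m + + a)
abs-fold-lowerBound {a} {m} a≤m (+ t) =
  subst (λ w → + a ℤ.≤ abs (w + + a)) (sym (pos-*³ 2 t m)) (+≤+ (ℕ.m≤n+m a (2 ℕ.* t ℕ.* m)))
abs-fold-lowerBound {a} {m} a≤m -[1+ t ] with ℕ.m≤n⇒∃[o]m+o≡n a≤m
... | r , refl = subst (+ a ℤ.≤_) (sym absValue) (+≤+ a≤N)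
  where
  N = 2 ℕ.* t ℕ.* (a ℕ.+ r) ℕ.+ a ℕ.+ 2 ℕ.* r
  negated : ∀ T A R → + 2 * (- (+ 1 + T)) * (A + R) + A ≡ - (+ 2 * T * (A + R) + A + + 2 * R)
  negated = solve-∀
  absValue : abs (+ 2 * -[1+ t ] * + (a ℕ.+ r) + + a) ≡ + N
  absValue = begin
    abs (+ 2 * -[1+ t ] * + (a ℕ.+ r) + + a)             ≡⟨ cong abs (negated (+ t) (+ a) (+ r)) ⟩
    abs (- (+ 2 * + t * (+ a + + r) + + a + + 2 * + r))  ≡⟨ abs-neg (+ 2 * + t * + (a ℕ.+ r) + + a + + 2 * + r) ⟩
    abs (+ 2 * + t * + (a ℕ.+ r) + + a + + 2 * + r)      ≡⟨ cong (λ w → abs (w + + a + + 2 * + r)) (pos-*³ 2 t (a ℕ.+ r)) ⟩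
    abs (+ (2 ℕ.* t ℕ.* (a ℕ.+ r)) + + a + + 2 * + r)    ≡⟨ cong (λ w → abs (+ (2 ℕ.* t ℕ.* (a ℕ.+ r)) + + a + w)) (sym (ℤ.pos-* 2 r)) ⟩
    + N                                                    ∎
    where open ≡-Reasoning
  a≤N : a ≤ N
  a≤N = ℕ.≤-trans (ℕ.m≤n+m a (2 ℕ.* t ℕ.* (a ℕ.+ r))) (ℕ.m≤m+n _ (2 ℕ.* r))

abs-reflection-lowerBound : ∀ {a m} → a ≤ m → ∀ d s → + a ℤ.≤ abs (+ 2 * d * + m + sgnPow s * + a)
abs-reflection-lowerBound {a} {m} a≤m d zero =
  subst (λ w → + a ℤ.≤ abs (+ 2 * d * + m + w)) (sym (ℤ.*-identityˡ (+ a))) (abs-fold-lowerBound a≤m d)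
abs-reflection-lowerBound {a} {m} a≤m d (suc zero) =
  subst (+ a ℤ.≤_) (sym absValue) (abs-fold-lowerBound a≤m (- d))
  where
  mirrored : ∀ D M A → + 2 * D * M + - A ≡ - (+ 2 * (- D) * M + A)
  mirrored = solve-∀
  absValue : abs (+ 2 * d * + m + sgnPow (suc zero) * + a) ≡ abs (+ 2 * (- d) * + m + + a)
  absValue = trans (cong (λ w → abs (+ 2 * d * + m + w)) (ℤ.-1*i≡-i (+ a)))
                   (trans (cong abs (mirrored d (+ m) (+ a))) (abs-neg (+ 2 * (- d) * + m + + a)))

IsPhi⇒reflection : ∀ m u {v} → IsPhi m u v → Σ (Fin 2) λ s → Σ ℤ λ n → u - + 2 * n * + m ≡ sgnPow s * v
IsPhi⇒reflection m u ((n , v≡) , _) with sgnPow-abs (u - + 2 * n * + m)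
... | s , sgn≡ = s , n , trans (sym sgn≡) (cong (sgnPow s *_) (sym v≡))

reflection⇒IsPhi : ∀ {m a} u n s → a ≤ m → u - + 2 * n * + m ≡ sgnPow s * + a → IsPhi m u (+ a)
reflection⇒IsPhi {m} {a} u n s a≤m reflected =
  (n , sym (trans (cong abs reflected) (abs-sgnPow s (+ a))))
  , λ n′ → subst (λ w → + a ℤ.≤ abs w) (sym (shifted n′)) (abs-reflection-lowerBound a≤m (n - n′) s)
  where
  recentre : ∀ U N N′ M → U - + 2 * N′ * M ≡ + 2 * (N - N′) * M + (U - + 2 * N * M)
  recentre = solve-∀
  shifted : ∀ n′ → u - + 2 * n′ * + m ≡ + 2 * (n - n′) * + m + sgnPow s * + a
  shifted n′ = trans (recentre u n n′ (+ m)) (cong (λ w → + 2 * (n - n′) * + m + w) reflected)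

lhsTerm≡⇔reflection : ∀ m x y s n k →
  lhsTerm m x y s n ≡ k ⇔ (x + k - + 2 * n * + m ≡ sgnPow s * y)
lhsTerm≡⇔reflection m x y s n k = mk⇔
  (λ eq → trans (cong (λ w → x + w - T) (sym eq)) (cancel₁ x T (sgnPow s * y)))
  (λ eq → trans (cong (λ w → T - x + w) (sym eq)) (cancel₂ x T k))
  where
  T = + 2 * n * + m
  cancel₁ : ∀ X T W → X + (T - X + W) - T ≡ W
  cancel₁ = solve-∀
  cancel₂ : ∀ X T K → T - X + (X + K - T) ≡ K
  cancel₂ = solve-∀

IsPhi⇒lhsTerm≡ : ∀ m x {y} k → IsPhi m (x + + k) y → Σ (Fin 2) λ s → Σ ℤ λ n → lhsTerm m x y s n ≡ + k
IsPhi⇒lhsTerm≡ m x {y} k φ with IsPhi⇒reflection m (x + + k) φ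
... | s , n , reflected = s , n , Equivalence.from (lhsTerm≡⇔reflection m x y s n (+ k)) reflected

lhsTerm≡⇒IsPhi : ∀ {m} x {y} s n k → + 0 ℤ.≤ y → y ℤ.≤ + m → lhsTerm m x y s n ≡ + k → IsPhi m (x + + k) y
lhsTerm≡⇒IsPhi {m} x {+ a} s n k _ (+≤+ a≤m) eq =
  reflection⇒IsPhi (x + + k) n s a≤m (Equivalence.to (lhsTerm≡⇔reflection m x (+ a) s n (+ k)) eq)

lhsTerm-shift : ∀ m x y s n Q q → lhsTerm m x y s (n - Q * + q) ≡ lhsTerm m x y s n - Q * + (2 ℕ.* (q ℕ.* m))
lhsTerm-shift m x y s n Q q = begin
  + 2 * (n - Q * + q) * + m - x + sgnPow s * y        ≡⟨ expand n Q (+ q) (+ m) x (sgnPow s * y) ⟩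
  lhsTerm m x y s n - Q * (+ 2 * (+ q * + m))         ≡⟨ cong (λ w → lhsTerm m x y s n - Q * w) (sym pos-2qm) ⟩
  lhsTerm m x y s n - Q * + (2 ℕ.* (q ℕ.* m))         ∎
  where
  open ≡-Reasoning
  expand : ∀ N Q q M X W → + 2 * (N - Q * q) * M - X + W ≡ (+ 2 * N * M - X + W) - Q * (+ 2 * (q * M))
  expand = solve-∀
  pos-2qm : + (2 ℕ.* (q ℕ.* m)) ≡ + 2 * (+ q * + m)
  pos-2qm = trans (ℤ.pos-* 2 (q ℕ.* m)) (cong (+ 2 *_) (ℤ.pos-* q m))

lhsTerm-shiftToValue : ∀ {m L c k} x y s n Q → m ∣ L → lhsTerm m x y s n ≡ c → c - Q * + (2 ℕ.* L) ≡ k →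
  Σ ℤ λ n′ → lhsTerm m x y s n′ ≡ k
lhsTerm-shiftToValue {m} {L} {c} {k} x y s n Q (divides q L≡qm) term≡c c-2QL≡k = n - Q * + q , (begin
  lhsTerm m x y s (n - Q * + q)                 ≡⟨ lhsTerm-shift m x y s n Q q ⟩
  lhsTerm m x y s n - Q * + (2 ℕ.* (q ℕ.* m))   ≡⟨ cong₂ (λ c l → c - Q * + (2 ℕ.* l)) term≡c (sym L≡qm) ⟩
  c - Q * + (2 ℕ.* L)                           ≡⟨ c-2QL≡k ⟩
  k                                             ∎)
  where open ≡-Reasoning

commonMultiple : ∀ {p} (m : Fin p → ℕ) → (∀ i → NonZero (m i)) → Σ ℕ λ L → NonZero L × (∀ i → m i ∣ L)
commonMultiple {ℕ.zero}  m _  = 1 , _ , λ ()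
commonMultiple {ℕ.suc p} m nz with commonMultiple (λ i → m (suc i)) (λ i → nz (suc i))
... | L , nzL , divL = m zero ℕ.* L , ℕ.m*n≢0 (m zero) L {{nz zero}} {{nzL}} , λ where
  zero    → m∣m*n L
  (suc i) → ∣n⇒∣m*n (m zero) (divL i)

natural-representative : ∀ c d .{{_ : NonZero d}} → Σ ℕ λ k → Σ ℤ λ Q → c - Q * + d ≡ + k
natural-representative c d =
  c %ℕ d , c /ℕ d , trans (cong (λ w → w - c /ℕ d * + d) (a≡a%ℕn+[a/ℕn]*n c d)) (cancel (+ (c %ℕ d)) (c /ℕ d) (+ d))
  where
  cancel : ∀ K Q D → K + Q * D - Q * D ≡ K
  cancel = solve-∀

theorem4p3 : (p : ℕ) → 2 ≤ p → (m : Fin p → ℕ) → ((i : Fin p) → 0 < m i) →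
    (x y : Fin p → ℤ) → InGrid p m x → InGrid p m y →
    (Σ ℕ (λ k → FPow≡ p m k x y))
      ⇔ Σ (Fin p → Fin 2) (λ ks → Σ (Fin p → ℤ) (λ n →
          (i j : Fin p) → lhsTerm (m i) (x i) (y i) (ks i) (n i) ≡ lhsTerm (m j) (x j) (y j) (ks j) (n j)))
theorem4p3 p@(ℕ.suc _) (ℕ.s≤s _) m m>0 x y _ y∈grid = mk⇔ common-value shift-to-natural
  where
  term : ∀ i → Fin 2 → ℤ → ℤ
  term i = lhsTerm (m i) (x i) (y i)
  Solvable : Set
  Solvable = Σ (Fin p → Fin 2) λ ks → Σ (Fin p → ℤ) λ n → (i j : Fin p) → term i (ks i) (n i) ≡ term j (ks j) (n j)

  common-value : Σ ℕ (λ k → FPow≡ p m k x y) → Solvable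
  common-value (k , φ) = (λ i → proj₁ (w i)) , (λ i → proj₁ (proj₂ (w i))) ,
                          λ i j → trans (proj₂ (proj₂ (w i))) (sym (proj₂ (proj₂ (w j))))
    where
    w : ∀ i → Σ (Fin 2) λ s → Σ ℤ λ n → term i s n ≡ + k
    w i = IsPhi⇒lhsTerm≡ (m i) (x i) k (φ i)

  shift-to-natural : Solvable → Σ ℕ (λ k → FPow≡ p m k x y)
  shift-to-natural (ks , n , common) with commonMultiple m (λ i → >-nonZero (m>0 i))
  ... | L , nzL , m∣L with natural-representative (term zero (ks zero) (n zero)) (2 ℕ.* L) {{ℕ.m*n≢0 2 L {{_}} {{nzL}}}}
  ... | k , Q , c-2QL≡k = k , λ i →
    let n′ , term≡k = lhsTerm-shiftToValue (x i) (y i) (ks i) (n i) Q (m∣L i) (common i zero) c-2QL≡k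
    in lhsTerm≡⇒IsPhi (x i) (ks i) n′ k (proj₁ (y∈grid i)) (proj₂ (y∈grid i)) term≡k
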